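{- Let $N'$ be a network with the global lca-property, and let $N$ be obtained from $N'$ by adding a new vertex $x\notin V(N')$ and edges $(w,x)$ for all $w\in W$, where $W\subseteq V(N')$ is non-empty (so $W$ is the set of parents of $x$ in $N$). Then $N$ has the global lca-property if and only if, for every $v\in V(N')$, the set $\mathcal{L}_{N'}(W\mid v)=\{\mathrm{lca}_{N'}(v,w): w\in W\}$ contains a unique $\preceq_{N'}$-minimal vertex.
   Context: A DAG is a finite directed graph without loops and directed cycles; $u\preceq_G v$ means there is a directed path from $v$ to $u$ (including $u=v$). A network is a DAG with exactly one $\preceq_G$-maximal vertex. For non-empty $A\subseteq V(G)$, $\mathrm{LCA}_G(A)$ is the set of $\preceq_G$-minimal vertices $u$ with $a\preceq_G u$ for all $a\in A$; $G$ has the global lca-property if $|\mathrm{LCA}_G(A)|=1$ for all non-empty $A\subseteq V(G)$, and then $\mathrm{lca}_G(a,b)$ denotes the unique element of $\mathrm{LCA}_G(\{a,b\})$. -}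

module Defs where

open import Data.Nat using (ℕ; suc)
open import Data.Fin using (Fin; zero; suc)
open import Data.Fin.Subset using (Subset; _∈_)
open import Data.Product using (Σ; ∃; _×_; _,_)
open import Data.Empty using (⊥)
open import Data.Sum using (_⊎_)
open import Relation.Nullary using (¬_)
open import Relation.Binary.PropositionalEquality using (_≡_)
open import Relation.Binary.Construct.Closure.ReflexiveTransitive using (Star)

-- A finite directed graph on vertex set Fin n, given by its edge relation:
-- E u v  means there is an edge (u , v).
Graph : ℕ → Set₁
Graph n = Fin n → Fin n → Set

_⪯[_]_ : ∀ {n} → Fin n → Graph n → Fin n → Set
u ⪯[ E ] v = Star E v u

IsDAG : ∀ {n} → Graph n → Set
IsDAG {n} E = (∀ v → ¬ E v v) × (∀ u v → E u v → ¬ (u ⪯[ E ] v))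

IsMaximal : ∀ {n} → Graph n → Fin n → Set
IsMaximal {n} E v = ∀ (u : Fin n) → v ⪯[ E ] u → u ≡ v

IsNetwork : ∀ {n} → Graph n → Set
IsNetwork {n} E = IsDAG E × Σ (Fin n) (λ r → IsMaximal E r × (∀ v → IsMaximal E v → v ≡ r))

VSet : ℕ → Set₁
VSet n = Fin n → Set

IsCA : ∀ {n} → Graph n → VSet n → Fin n → Set
IsCA E A u = ∀ a → A a → a ⪯[ E ] u

IsLCA : ∀ {n} → Graph n → VSet n → Fin n → Set
IsLCA {n} E A u = IsCA E A u × (∀ (u' : Fin n) → IsCA E A u' → u' ⪯[ E ] u → u' ≡ u)

UniqueLCA : ∀ {n} → Graph n → VSet n → Set
UniqueLCA {n} E A = Σ (Fin n) (λ u → IsLCA E A u × (∀ v → IsLCA E A v → v ≡ u))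

GlobalLCA : ∀ {n} → Graph n → Set
GlobalLCA {n} E = ∀ (A : Subset n) → ∃ (λ a → a ∈ A) → UniqueLCA E (λ v → v ∈ A)

Pair : ∀ {n} → Fin n → Fin n → VSet n
Pair a b v = (v ≡ a) ⊎ (v ≡ b)

-- L_{N'}(W | v) = { lca(v , w) : w ∈ W }
-- (membership: u = lca(v,w) for some w ∈ W, i.e. u ∈ LCA({v,w}), which is
-- the unique element when the lca-property holds)
LSet : ∀ {n} → Graph n → Subset n → Fin n → VSet n
LSet E W v u = ∃ (λ w → w ∈ W × IsLCA E (Pair v w) u)

HasUniqueMinimal : ∀ {n} → Graph n → VSet n → Set
HasUniqueMinimal {n} E S =
  Σ (Fin n) (λ u → (S u × (∀ u' → S u' → u' ⪯[ E ] u → u' ≡ u))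
    × (∀ v → (S v × (∀ u' → S u' → u' ⪯[ E ] v → u' ≡ v)) → v ≡ u))

-- N obtained from N' (on Fin n) by adding a new vertex x (= zero of Fin (suc n);
-- the old vertex a is suc a) with edges (w , x) for all w ∈ W.
addVertex : ∀ {n} → Graph n → Subset n → Graph (suc n)
addVertex E W zero    _       = ⊥
addVertex E W (suc a) zero    = a ∈ W
addVertex E W (suc a) (suc b) = E a b

-- Write x for the new vertex; it is a leaf whose ancestors are x and the
-- ancestors of W. For A ⊆ V(N) with x ∉ A the common ancestors of A in N are
-- those in N′. For A = A′ ∪ {x} with A′ ≠ ∅ and l = lca(A′), a vertex is a
-- common ancestor of A iff it lies above l and above some w ∈ W, i.e. iff it
-- lies above some lca(l, w) with w ∈ W; so LCA_N(A) is the set of minimal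
-- elements of L(W | l), and every v ∈ V(N′) arises as such an l, from A = {v, x}.
-- The step "above l and w ⇒ above lca(l, w)" needs that a unique minimal
-- common ancestor is the least one. This holds in a finite partial order with
-- decidable ⪯, and ⪯ is decidable because u ⪯ v iff lca(u, v) = v.
module Submission where

open import Defs
open import Data.Nat using (ℕ; suc)
open import Data.Fin using (Fin; zero; suc; _≟_)
open import Data.Fin.Properties using (any?; all?; suc-injective)
open import Data.Fin.Induction using (po-wellFounded)
open import Data.Fin.Subset using (Subset; _∈_; ⁅_⁆; _∪_; inside; outside; Nonempty; Empty)
open import Data.Fin.Subset.Properties
  using (_∈?_; x∈⁅x⁆; x∈⁅y⁆⇒x≡y; x∈p∪q⁺; x∈p∪q⁻; nonempty?)
open import Data.Vec.Base using (_∷_; here; there)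
open import Data.Empty using (⊥-elim)
open import Data.Product using (Σ; ∃; _×_; _,_; proj₁)
import Data.Product as Product
open import Data.Sum using (inj₁; inj₂)
import Data.Sum as Sum
open import Function using (_∘_)
open import Function.Bundles using (_⇔_; mk⇔; Equivalence)
open import Function.Construct.Composition using (_⇔-∘_)
open import Induction.WellFounded using (Acc; acc)
open import Level using (0ℓ)
open import Relation.Binary.Core using (Rel)
open import Relation.Binary.Definitions using (Transitive; Antisymmetric; Decidable)
open import Relation.Binary.Structures using (IsPartialOrder)
import Relation.Binary.Construct.NonStrictToStrict as ToStrict
open import Relation.Binary.Construct.Closure.ReflexiveTransitive using (ε; _◅_; _◅◅_)
open import Relation.Binary.PropositionalEquality using (_≡_; refl; sym; cong; subst; isEquivalence)
open import Relation.Nullary using (¬_; yes; no)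
open import Relation.Nullary.Decidable using (_⊎-dec_; _→-dec_; decidable-stable)
open import Relation.Unary using (Pred; _⊆_; _∩_; _≐_)
import Relation.Unary as Unary
open import Relation.Unary.Properties using (_∩?_; ≐-trans)

private
  variable
    A : Set
    n : ℕ

-- IsLCA E S, UniqueLCA E S and HasUniqueMinimal E S unfold to Minimal _⪯[ E ]_ (IsCA E S),
-- UniqueMinimal _⪯[ E ]_ (IsCA E S) and UniqueMinimal _⪯[ E ]_ S.
Minimal : Rel A 0ℓ → Pred A 0ℓ → Pred A 0ℓ
Minimal _≤_ P m = P m × (∀ u → P u → u ≤ m → u ≡ m)

UniqueMinimal : Rel A 0ℓ → Pred A 0ℓ → Set
UniqueMinimal {A} _≤_ P = Σ A (λ m → Minimal _≤_ P m × (∀ u → Minimal _≤_ P u → u ≡ m))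

UpperClosure : Rel A 0ℓ → Pred A 0ℓ → Pred A 0ℓ
UpperClosure _≤_ S u = ∃ λ s → S s × s ≤ u

∩-congˡ : {P Q Q′ : Pred A 0ℓ} → Q ≐ Q′ → P ∩ Q ≐ P ∩ Q′
∩-congˡ (Q⊆Q′ , Q′⊆Q) = Product.map₂ Q⊆Q′ , Product.map₂ Q′⊆Q

module _ {_≤_ : Rel A 0ℓ} {P Q : Pred A 0ℓ} where

  uniqueMinimal-resp-Minimal : Minimal _≤_ P ≐ Minimal _≤_ Q →
                               UniqueMinimal _≤_ P → UniqueMinimal _≤_ Q
  uniqueMinimal-resp-Minimal (P⊆Q , Q⊆P) (m , m-min , unique) =
    m , P⊆Q m-min , λ u → unique u ∘ Q⊆P

  minimal-resp-≐ : P ≐ Q → Minimal _≤_ P ≐ Minimal _≤_ Q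
  minimal-resp-≐ (P⊆Q , Q⊆P) = transport P⊆Q Q⊆P , transport Q⊆P P⊆Q
    where
    transport : {S T : Pred A 0ℓ} → S ⊆ T → T ⊆ S → Minimal _≤_ S ⊆ Minimal _≤_ T
    transport S⊆T T⊆S (sm , minimal) = S⊆T sm , λ u → minimal u ∘ T⊆S

  uniqueMinimal-resp-≐ : P ≐ Q → UniqueMinimal _≤_ P → UniqueMinimal _≤_ Q
  uniqueMinimal-resp-≐ = uniqueMinimal-resp-Minimal ∘ minimal-resp-≐

module _ {_≤_ : Rel A 0ℓ} (≤-isPartialOrder : IsPartialOrder _≡_ _≤_) {S : Pred A 0ℓ} where
  open IsPartialOrder ≤-isPartialOrder using (antisym; trans) renaming (refl to ≤-refl)

  minimal-upperClosure : Minimal _≤_ (UpperClosure _≤_ S) ≐ Minimal _≤_ S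
  minimal-upperClosure = lower , raise
    where
    lower : Minimal _≤_ (UpperClosure _≤_ S) ⊆ Minimal _≤_ S
    lower ((s , s∈S , s≤m) , minimal) with refl ← minimal s (s , s∈S , ≤-refl) s≤m =
      s∈S , λ u u∈S → minimal u (u , u∈S , ≤-refl)

    raise : Minimal _≤_ S ⊆ Minimal _≤_ (UpperClosure _≤_ S)
    raise {m} (m∈S , minimal) = (m , m∈S , ≤-refl) , λ u (s , s∈S , s≤u) u≤m →
      antisym u≤m (subst (_≤ u) (minimal s s∈S (trans s≤u u≤m)) s≤u)

  uniqueMinimal-upperClosure⇔ : UniqueMinimal _≤_ (UpperClosure _≤_ S) ⇔ UniqueMinimal _≤_ S
  uniqueMinimal-upperClosure⇔ = mk⇔
    (uniqueMinimal-resp-Minimal minimal-upperClosure)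
    (uniqueMinimal-resp-Minimal (Product.swap minimal-upperClosure))

module _ {_≤_ : Rel (Fin n) 0ℓ} (≤-isPartialOrder : IsPartialOrder _≡_ _≤_)
         (_≤?_ : Decidable _≤_) {P : Pred (Fin n) 0ℓ} (P? : Unary.Decidable P) where
  open IsPartialOrder ≤-isPartialOrder using (trans) renaming (refl to ≤-refl)
  open ToStrict _≡_ _≤_ using (_<_; <-decidable)

  minimal-below : ∀ {u} → P u → ∃ λ m → Minimal _≤_ P m × m ≤ u
  minimal-below {u} = search (po-wellFounded ≤-isPartialOrder u)
    where
    search : ∀ {u} → Acc _<_ u → P u → ∃ λ m → Minimal _≤_ P m × m ≤ u
    search {u} (acc smaller) u∈P with any? (P? ∩? (λ v → <-decidable _≟_ _≤?_ v u))
    ... | yes (v , v∈P , v<u) =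
      let m , m-min , m≤v = search (smaller v<u) v∈P in m , m-min , trans m≤v (proj₁ v<u)
    ... | no ∄v<u = u , (u∈P , minimal) , ≤-refl
      where
      minimal : ∀ v → P v → v ≤ u → v ≡ u
      minimal v v∈P v≤u = decidable-stable (v ≟ u) λ v≢u → ∄v<u (v , v∈P , v≤u , v≢u)

  uniqueMinimal⇒least : ((m , _) : UniqueMinimal _≤_ P) → ∀ {u} → P u → m ≤ u
  uniqueMinimal⇒least (_ , _ , unique) u∈P =
    let m , m-min , m≤u = minimal-below u∈P in subst (_≤ _) (unique m m-min) m≤u

uniqueMinimal-suc⇔ : {_≤′_ : Rel (Fin (suc n)) 0ℓ} {_≤_ : Rel (Fin n) 0ℓ}
                     {Q : Pred (Fin (suc n)) 0ℓ} {P : Pred (Fin n) 0ℓ} →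
                     (∀ {a b} → suc a ≤′ suc b ⇔ a ≤ b) → ¬ Q zero → Q ∘ suc ≐ P →
                     UniqueMinimal _≤′_ Q ⇔ UniqueMinimal _≤_ P
uniqueMinimal-suc⇔ {_≤′_ = _≤′_} {_≤_} {Q} {P} suc-≤⇔ zero∉Q (Q⊆P , P⊆Q) = mk⇔ to from
  where
  lower : ∀ {m} → Minimal _≤′_ Q (suc m) → Minimal _≤_ P m
  lower (m∈Q , minimal) = Q⊆P m∈Q , λ u u∈P u≤m →
    suc-injective (minimal (suc u) (P⊆Q u∈P) (Equivalence.from suc-≤⇔ u≤m))

  raise : ∀ {m} → Minimal _≤_ P m → Minimal _≤′_ Q (suc m)
  raise (m∈P , minimal) = P⊆Q m∈P , λ
    { zero zero∈Q _ → ⊥-elim (zero∉Q zero∈Q)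
    ; (suc u) u∈Q u≤m → cong suc (minimal u (Q⊆P u∈Q) (Equivalence.to suc-≤⇔ u≤m)) }

  to : UniqueMinimal _≤′_ Q → UniqueMinimal _≤_ P
  to (zero , (zero∈Q , _) , _) = ⊥-elim (zero∉Q zero∈Q)
  to (suc m , m-min , unique) = m , lower m-min , λ u → suc-injective ∘ unique (suc u) ∘ raise

  from : UniqueMinimal _≤_ P → UniqueMinimal _≤′_ Q
  from (m , m-min , unique) = suc m , raise m-min , λ
    { zero (zero∈Q , _) → ⊥-elim (zero∉Q zero∈Q)
    ; (suc u) u-min → cong suc (unique u (lower u-min)) }

module _ {E : Graph n} where

  ⪯-trans : Transitive _⪯[ E ]_
  ⪯-trans p q = q ◅◅ p

  ⪯-antisym : IsDAG E → Antisymmetric _≡_ _⪯[ E ]_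
  ⪯-antisym _ ε _ = refl
  ⪯-antisym (_ , acyclic) (e ◅ p) q = ⊥-elim (acyclic _ _ e (p ◅◅ q))

  ⪯-isPartialOrder : IsDAG E → IsPartialOrder _≡_ _⪯[ E ]_
  ⪯-isPartialOrder dag = record
    { isPreorder = record
      { isEquivalence = isEquivalence
      ; reflexive     = λ { refl → ε }
      ; trans         = ⪯-trans
      }
    ; antisym    = ⪯-antisym dag
    }

  IsCA-resp-≐ : {S T : VSet n} → S ≐ T → IsCA E S ≐ IsCA E T
  IsCA-resp-≐ (S⊆T , T⊆S) = (λ ca a → ca a ∘ T⊆S) , (λ ca a → ca a ∘ S⊆T)

  IsCA-⁅⁆ : ∀ {v} → IsCA E (_∈ ⁅ v ⁆) ≐ (v ⪯[ E ]_)
  IsCA-⁅⁆ {v} = (λ ca → ca v (x∈⁅x⁆ v)) , λ {u} v⪯u a a∈⁅v⁆ →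
    subst (_⪯[ E ] u) (sym (x∈⁅y⁆⇒x≡y v a∈⁅v⁆)) v⪯u

  ⪯⇒isLCA-Pair : IsDAG E → ∀ {u v} → u ⪯[ E ] v → IsLCA E (Pair u v) v
  ⪯⇒isLCA-Pair dag u⪯v = (λ { _ (inj₁ refl) → u⪯v ; _ (inj₂ refl) → ε })
                        , λ w w-ca w⪯v → ⪯-antisym dag w⪯v (w-ca _ (inj₂ refl))

  module _ (dag : IsDAG E) (global : GlobalLCA E) where

    uniqueLCA-Pair : ∀ a b → UniqueLCA E (Pair a b)
    uniqueLCA-Pair a b = uniqueMinimal-resp-≐ (IsCA-resp-≐ (⁅a⁆∪⁅b⁆⊆Pair , Pair⊆⁅a⁆∪⁅b⁆))
                           (global (⁅ a ⁆ ∪ ⁅ b ⁆) (a , Pair⊆⁅a⁆∪⁅b⁆ (inj₁ refl)))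
      where
      ⁅a⁆∪⁅b⁆⊆Pair : (_∈ ⁅ a ⁆ ∪ ⁅ b ⁆) ⊆ Pair a b
      ⁅a⁆∪⁅b⁆⊆Pair = Sum.map (x∈⁅y⁆⇒x≡y a) (x∈⁅y⁆⇒x≡y b) ∘ x∈p∪q⁻ _ _

      Pair⊆⁅a⁆∪⁅b⁆ : Pair a b ⊆ (_∈ ⁅ a ⁆ ∪ ⁅ b ⁆)
      Pair⊆⁅a⁆∪⁅b⁆ (inj₁ refl) = x∈p∪q⁺ (inj₁ (x∈⁅x⁆ a))
      Pair⊆⁅a⁆∪⁅b⁆ (inj₂ refl) = x∈p∪q⁺ {p = ⁅ a ⁆} (inj₂ (x∈⁅x⁆ b))

    _⪯?_ : Decidable _⪯[ E ]_
    u ⪯? v with uniqueLCA-Pair u v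
    ... | c , (c-ca , _) , unique with c ≟ v
    ...   | yes refl = yes (c-ca u (inj₁ refl))
    ...   | no c≢v = no λ u⪯v → c≢v (sym (unique v (⪯⇒isLCA-Pair dag u⪯v)))

    IsCA? : {S : VSet n} → Unary.Decidable S → Unary.Decidable (IsCA E S)
    IsCA? S? u = all? (λ a → S? a →-dec (a ⪯? u))

    lca-least : {S : VSet n} → Unary.Decidable S → ((l , _) : UniqueLCA E S) →
                ∀ {u} → IsCA E S u → l ⪯[ E ] u
    lca-least S? = uniqueMinimal⇒least (⪯-isPartialOrder dag) _⪯?_ (IsCA? S?)

    IsCA≐lca⪯ : {S : VSet n} → Unary.Decidable S → ((l , _) : UniqueLCA E S) →
                IsCA E S ≐ (l ⪯[ E ]_)
    IsCA≐lca⪯ S? L@(_ , (l-ca , _) , _) =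
      lca-least S? L , λ l⪯u a a∈S → ⪯-trans (l-ca a a∈S) l⪯u

    upperClosure-LSet : ∀ {W l} →
      UpperClosure _⪯[ E ]_ (_∈ W) ∩ (l ⪯[ E ]_) ≐ UpperClosure _⪯[ E ]_ (LSet E W l)
    upperClosure-LSet {W} {l} = above-lca , above-l-and-w
      where
      above-lca : UpperClosure _⪯[ E ]_ (_∈ W) ∩ (l ⪯[ E ]_) ⊆
                  UpperClosure _⪯[ E ]_ (LSet E W l)
      above-lca ((w , w∈W , w⪯u) , l⪯u) =
        let L@(c , c-lca , _) = uniqueLCA-Pair l w
            Pair? a = (a ≟ l) ⊎-dec (a ≟ w)
        in c , (w , w∈W , c-lca) , lca-least Pair? L λ { _ (inj₁ refl) → l⪯u ; _ (inj₂ refl) → w⪯u }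

      above-l-and-w : UpperClosure _⪯[ E ]_ (LSet E W l) ⊆
                      UpperClosure _⪯[ E ]_ (_∈ W) ∩ (l ⪯[ E ]_)
      above-l-and-w (c , (w , w∈W , c-ca , _) , c⪯u) =
        (w , w∈W , ⪯-trans (c-ca w (inj₂ refl)) c⪯u) , ⪯-trans (c-ca l (inj₁ refl)) c⪯u

module AddVertex {E : Graph n} {W : Subset n} where

  private
    N : Graph (suc n)
    N = addVertex E W

  ⪯zero⇒≡zero : ∀ {u} → u ⪯[ N ] zero → u ≡ zero
  ⪯zero⇒≡zero ε = refl

  suc-cancel-⪯ : ∀ {u v} → suc u ⪯[ N ] suc v → u ⪯[ E ] v
  suc-cancel-⪯ ε = ε
  suc-cancel-⪯ (_◅_ {j = zero} _ p) with () ← ⪯zero⇒≡zero p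
  suc-cancel-⪯ (_◅_ {j = suc _} e p) = e ◅ suc-cancel-⪯ p

  suc-mono-⪯ : ∀ {u v} → u ⪯[ E ] v → suc u ⪯[ N ] suc v
  suc-mono-⪯ ε = ε
  suc-mono-⪯ (e ◅ p) = e ◅ suc-mono-⪯ p

  suc-⪯-suc⇔ : ∀ {u v} → suc u ⪯[ N ] suc v ⇔ u ⪯[ E ] v
  suc-⪯-suc⇔ = mk⇔ suc-cancel-⪯ suc-mono-⪯

  zero⪯suc⇒ : ∀ {v} → zero ⪯[ N ] suc v → UpperClosure _⪯[ E ]_ (_∈ W) v
  zero⪯suc⇒ {v} (_◅_ {j = zero} v∈W _) = v , v∈W , ε
  zero⪯suc⇒ (_◅_ {j = suc _} e p) =
    let w , w∈W , w⪯ = zero⪯suc⇒ p in w , w∈W , ⪯-trans w⪯ (e ◅ ε)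

  zero⪯suc⇐ : ∀ {v} → UpperClosure _⪯[ E ]_ (_∈ W) v → zero ⪯[ N ] suc v
  zero⪯suc⇐ (_ , w∈W , w⪯v) = suc-mono-⪯ w⪯v ◅◅ (w∈W ◅ ε)

  zero∉IsCA : ∀ {b} {A : Subset n} → Nonempty A → ¬ IsCA N (_∈ b ∷ A) zero
  zero∉IsCA (a , a∈A) ca with () ← ⪯zero⇒≡zero (ca (suc a) (there a∈A))

  IsCA-outside : ∀ {A} → IsCA N (_∈ outside ∷ A) ∘ suc ≐ IsCA E (_∈ A)
  IsCA-outside = (λ ca a → suc-cancel-⪯ ∘ ca (suc a) ∘ there) , extend
    where
    extend : ∀ {A u} → IsCA E (_∈ A) u → IsCA N (_∈ outside ∷ A) (suc u)
    extend ca (suc a) (there a∈A) = suc-mono-⪯ (ca a a∈A)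

  IsCA-inside : ∀ {A} →
    IsCA N (_∈ inside ∷ A) ∘ suc ≐ UpperClosure _⪯[ E ]_ (_∈ W) ∩ IsCA E (_∈ A)
  IsCA-inside = (λ ca → zero⪯suc⇒ (ca zero here) , λ a → suc-cancel-⪯ ∘ ca (suc a) ∘ there)
              , extend
    where
    extend : ∀ {A u} → (UpperClosure _⪯[ E ]_ (_∈ W) ∩ IsCA E (_∈ A)) u →
             IsCA N (_∈ inside ∷ A) (suc u)
    extend (above-W , _) zero here = zero⪯suc⇐ above-W
    extend (_ , ca) (suc a) (there a∈A) = suc-mono-⪯ (ca a a∈A)

  uniqueLCA-outside⇔ : ∀ {A} → Nonempty A → UniqueLCA N (_∈ outside ∷ A) ⇔ UniqueLCA E (_∈ A)
  uniqueLCA-outside⇔ ne = uniqueMinimal-suc⇔ suc-⪯-suc⇔ (zero∉IsCA ne) IsCA-outside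

  uniqueLCA-inside⇔ : IsDAG E → GlobalLCA E →
                      ∀ {A l} → Nonempty A → IsCA E (_∈ A) ≐ (l ⪯[ E ]_) →
                      UniqueLCA N (_∈ inside ∷ A) ⇔ HasUniqueMinimal E (LSet E W l)
  uniqueLCA-inside⇔ dag global ne IsCA≐ =
    uniqueMinimal-upperClosure⇔ (⪯-isPartialOrder dag) ⇔-∘
    uniqueMinimal-suc⇔ suc-⪯-suc⇔ (zero∉IsCA ne)
      (≐-trans IsCA-inside (≐-trans (∩-congˡ IsCA≐) (upperClosure-LSet dag global)))

  uniqueLCA-⁅zero⁆ : ∀ {A} → Empty A → UniqueLCA N (_∈ inside ∷ A)
  uniqueLCA-⁅zero⁆ {A} empty =
    zero , (zero-ca , λ _ _ → ⪯zero⇒≡zero) ,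
    λ v (v-ca , v-min) → sym (v-min zero zero-ca (v-ca zero here))
    where
    zero-ca : IsCA N (_∈ inside ∷ A) zero
    zero-ca zero here = ε
    zero-ca (suc a) (there a∈A) = ⊥-elim (empty (a , a∈A))

open AddVertex

lemma5p3 : (n : ℕ) (E : Graph n) (W : Subset n) →
    IsNetwork E → GlobalLCA E → ∃ (λ w → w ∈ W) →
    (GlobalLCA (addVertex E W) ⇔ (∀ v → HasUniqueMinimal E (LSet E W v)))
lemma5p3 n E W (dag , _) global _ = mk⇔ minimal-LSet globalLCA-N
  where
  minimal-LSet : GlobalLCA (addVertex E W) → ∀ v → HasUniqueMinimal E (LSet E W v)
  minimal-LSet globalN v = Equivalence.to (uniqueLCA-inside⇔ dag global (v , x∈⁅x⁆ v) IsCA-⁅⁆)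
                                          (globalN (inside ∷ ⁅ v ⁆) (zero , here))

  globalLCA-N : (∀ v → HasUniqueMinimal E (LSet E W v)) → GlobalLCA (addVertex E W)
  globalLCA-N unique (outside ∷ A) (suc a , there a∈A) =
    Equivalence.from (uniqueLCA-outside⇔ (a , a∈A)) (global A (a , a∈A))
  globalLCA-N unique (inside ∷ A) _ with nonempty? A
  ... | no empty = uniqueLCA-⁅zero⁆ empty
  ... | yes ne =
    let L@(l , _) = global A ne
        IsCA≐ = IsCA≐lca⪯ dag global (_∈? A) L
    in Equivalence.from (uniqueLCA-inside⇔ dag global ne IsCA≐) (unique l)
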